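{- Every linear depth-$2$ circuit $F$ (computing a linear operator) satisfies $\mathrm{width}(F)\geq \mathrm{mr}(A_F)$.
   Context: A depth-$2$ circuit of width $w$ with $n$ inputs and $m$ outputs has $w$ gates $h_1,\dots,h_w$ (functions of the inputs) on the middle layer and $m$ output gates $g_1,\dots,g_m$, where $g_i$ is a function of the middle-layer values and of those inputs $x_j$ connected to it by a direct input-output wire. A circuit is linear if all its gates are linear (parity) functions over $GF_2$; it then computes a linear operator $\mathbf{x}\mapsto M\mathbf{x}$ for an $m$-by-$n$ $(0,1)$-matrix $M$. $A_F$ is the $(0,1,\ast)$-matrix obtained from $M$ by replacing entry $(i,j)$ by $\ast$ whenever there is a direct wire from $x_j$ to the $i$th output gate. A completion of a $(0,1,\ast)$-matrix is obtained by replacing each $\ast$ by $0$ or $1$; $\mathrm{mr}(A)$ is the minimum $GF_2$-rank of a completion of $A$. -}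

module Defs where

open import Data.Bool using (Bool; true; false; _xor_; _∧_; if_then_else_)
open import Data.Nat using (ℕ; zero; suc; _≤_)
open import Data.Fin using (Fin; zero; suc)
open import Data.Product using (Σ; _×_; _,_)
open import Data.Unit using (⊤)
open import Relation.Binary.PropositionalEquality using (_≡_)

-- (0,1)-matrices over GF(2) = Bool with xor as + and ∧ as *
Mat : ℕ → ℕ → Set
Mat m n = Fin m → Fin n → Bool

⊕ : ∀ {n} → (Fin n → Bool) → Bool
⊕ {zero}  f = false
⊕ {suc n} f = f zero xor ⊕ (λ i → f (suc i))

_·_ : ∀ {m k n} → Mat m k → Mat k n → Mat m n
(A · B) i j = ⊕ (λ l → A i l ∧ B l j)

_⊞_ : ∀ {m n} → Mat m n → Mat m n → Mat m n
(A ⊞ B) i j = A i j xor B i j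

LinIndepRows : ∀ {m n r} → Mat m n → (Fin r → Fin m) → Set
LinIndepRows {n = n} {r = r} M ι =
  (c : Fin r → Bool) →
  (∀ (j : Fin n) → ⊕ (λ l → c l ∧ M (ι l) j) ≡ false) →
  ∀ l → c l ≡ false

HasRank : ∀ {m n} → Mat m n → ℕ → Set
HasRank {m} M r =
  Σ (Fin r → Fin m) (LinIndepRows M) ×
  (∀ (k : ℕ) (ι : Fin k → Fin m) → LinIndepRows M ι → k ≤ r)

data Entry : Set where
  ∗   : Entry
  val : Bool → Entry

PMat : ℕ → ℕ → Set
PMat m n = Fin m → Fin n → Entry

Fills : Entry → Bool → Set
Fills ∗       b = ⊤
Fills (val a) b = a ≡ b

IsCompletion : ∀ {m n} → PMat m n → Mat m n → Set
IsCompletion A N = ∀ i j → Fills (A i j) (N i j)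

MinRank : ∀ {m n} → PMat m n → ℕ → Set
MinRank {m} {n} A r =
  Σ (Mat m n) (λ N → IsCompletion A N × HasRank N r) ×
  (∀ (N : Mat m n) (s : ℕ) → IsCompletion A N → HasRank N s → r ≤ s)

-- A linear depth-2 circuit with n inputs, m outputs.
--  middle gate h_k(x) = Σ_j H k j x_j
--  output gate g_i = Σ_k G i k h_k + Σ_j C i j x_j, where C i j may be 1
--  only if there is a direct wire (D i j = true) from x_j to g_i.
record LinDepth2 (n m : ℕ) : Set where
  field
    width   : ℕ
    H       : Mat width n
    G       : Mat m width
    D       : Mat m n
    C       : Mat m n
    C-wired : ∀ i j → C i j ≡ true → D i j ≡ true

  M : Mat m n
  M = (G · H) ⊞ C

  A : PMat m n
  A i j = if D i j then ∗ else val (M i j)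

open LinDepth2 public

-- Off the direct wires the circuit matrix M = G·H ⊞ C agrees with G·H, so G·H
-- is itself a completion of A_F and mr(A_F) ≤ rank(G·H).  Every row of G·H
-- is a combination of the w rows of H, and Gaussian elimination shows that
-- more than w such combinations are linearly dependent; hence rank(G·H) ≤ w.
module Submission where

open import Defs
open import Data.Nat using (ℕ; zero; suc; _≤_; _<_; s≤s; _≤?_)
open import Data.Nat.Properties using (≤-trans; ≰⇒>; m≤n⇒m≤1+n)
open import Data.Bool using (Bool; true; false; _xor_; _∧_)
open import Data.Bool.Properties
  using (_≟_; xor-comm; xor-same; xor-identityʳ; ∧-assoc; ∧-identityʳ; ∧-zeroʳ;
         ∧-distribˡ-xor; ¬-not; xor-∧-commutativeRing)
open import Data.Fin using (Fin; zero; suc; punchIn)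
open import Data.Fin.Properties using (any?; all?)
open import Data.Fin.Subset.Properties using (anySubset?)
open import Data.Vec using (lookup; tabulate)
open import Data.Vec.Properties using (lookup∘tabulate)
open import Data.Vec.Functional using (_∷_; insertAt; removeAt)
open import Data.Vec.Functional.Properties using (insertAt-lookup; insertAt-punchIn)
open import Data.Product using (∃; _×_; _,_; proj₁; proj₂)
open import Data.Unit using (tt)
open import Function using (_∘_)
open import Relation.Nullary using (Dec; yes; no; ¬_; contradiction)
open import Relation.Nullary.Decidable using (map′)
open import Relation.Binary.PropositionalEquality
open import Algebra.Bundles using (CommutativeRing)
open CommutativeRing xor-∧-commutativeRing using (semiring)
import Algebra.Properties.Semiring.Sum semiring as Sum

xor≡false⇒≡ : ∀ {x y} → x xor y ≡ false → x ≡ y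
xor≡false⇒≡ {false} {false} _ = refl
xor≡false⇒≡ {true}  {true}  _ = refl

-- ⊕ is the library's sum in the ring (Bool, xor, ∧); its laws are transported.
⊕≗sum : ∀ {n} (f : Fin n → Bool) → ⊕ f ≡ Sum.sum f
⊕≗sum {zero}  f = refl
⊕≗sum {suc n} f = cong (f zero xor_) (⊕≗sum (f ∘ suc))

⊕-cong : ∀ {n} {f g : Fin n → Bool} → (∀ i → f i ≡ g i) → ⊕ f ≡ ⊕ g
⊕-cong {f = f} {g} f≗g =
  trans (⊕≗sum f) (trans (Sum.sum-cong-≗ {x = f} {y = g} f≗g) (sym (⊕≗sum g)))

⊕-zero : ∀ {n} {f : Fin n → Bool} → (∀ i → f i ≡ false) → ⊕ f ≡ false
⊕-zero {n} f≗0 =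
  trans (⊕-cong f≗0) (trans (⊕≗sum {n} (λ _ → false)) (Sum.sum-replicate-zero n))

⊕-distrib-xor : ∀ {n} (f g : Fin n → Bool) → ⊕ (λ i → f i xor g i) ≡ ⊕ f xor ⊕ g
⊕-distrib-xor f g = begin
  ⊕ (λ i → f i xor g i)         ≡⟨ ⊕≗sum (λ i → f i xor g i) ⟩
  Sum.sum (λ i → f i xor g i)   ≡⟨ Sum.∑-distrib-+ f g ⟩
  Sum.sum f xor Sum.sum g       ≡⟨ cong₂ _xor_ (⊕≗sum f) (⊕≗sum g) ⟨
  ⊕ f xor ⊕ g                   ∎
  where open ≡-Reasoning

∧-distribˡ-⊕ : ∀ {n} b (f : Fin n → Bool) → b ∧ ⊕ f ≡ ⊕ (λ i → b ∧ f i)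
∧-distribˡ-⊕ b f = begin
  b ∧ ⊕ f                  ≡⟨ cong (b ∧_) (⊕≗sum f) ⟩
  b ∧ Sum.sum f            ≡⟨ Sum.*-distribˡ-sum b f ⟩
  Sum.sum (λ i → b ∧ f i)  ≡⟨ ⊕≗sum (λ i → b ∧ f i) ⟨
  ⊕ (λ i → b ∧ f i)        ∎
  where open ≡-Reasoning

∧-distribʳ-⊕ : ∀ {n} b (f : Fin n → Bool) → ⊕ f ∧ b ≡ ⊕ (λ i → f i ∧ b)
∧-distribʳ-⊕ b f = begin
  ⊕ f ∧ b                  ≡⟨ cong (_∧ b) (⊕≗sum f) ⟩
  Sum.sum f ∧ b            ≡⟨ Sum.*-distribʳ-sum b f ⟩
  Sum.sum (λ i → f i ∧ b)  ≡⟨ ⊕≗sum (λ i → f i ∧ b) ⟨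
  ⊕ (λ i → f i ∧ b)        ∎
  where open ≡-Reasoning

⊕-comm : ∀ {m n} (f : Fin m → Fin n → Bool) →
         ⊕ (λ i → ⊕ (f i)) ≡ ⊕ (λ j → ⊕ (λ i → f i j))
⊕-comm f = begin
  ⊕ (λ i → ⊕ (f i))                      ≡⟨ ⊕-cong (⊕≗sum ∘ f) ⟩
  ⊕ (λ i → Sum.sum (f i))                ≡⟨ ⊕≗sum (λ i → Sum.sum (f i)) ⟩
  Sum.sum (λ i → Sum.sum (f i))          ≡⟨ Sum.∑-comm f ⟩
  Sum.sum (λ j → Sum.sum (λ i → f i j))  ≡⟨ ⊕≗sum (λ j → Sum.sum (λ i → f i j)) ⟨
  ⊕ (λ j → Sum.sum (λ i → f i j))        ≡⟨ ⊕-cong (λ j → ⊕≗sum (λ i → f i j)) ⟨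
  ⊕ (λ j → ⊕ (λ i → f i j))              ∎
  where open ≡-Reasoning

⊕-removeAt : ∀ {n} (f : Fin (suc n) → Bool) i → ⊕ f ≡ f i xor ⊕ (removeAt f i)
⊕-removeAt f i = begin
  ⊕ f                                ≡⟨ ⊕≗sum f ⟩
  Sum.sum f                          ≡⟨ Sum.sum-remove f ⟩
  f i xor Sum.sum (removeAt f i)     ≡⟨ cong (f i xor_) (⊕≗sum (removeAt f i)) ⟨
  f i xor ⊕ (removeAt f i)           ∎
  where open ≡-Reasoning

lincomb : ∀ {k n} → (Fin k → Bool) → Mat k n → Fin n → Bool
lincomb c V j = ⊕ (λ l → c l ∧ V l j)

lincomb-zeroˡ : ∀ {k n} {c : Fin k → Bool} (V : Mat k n) →
                (∀ l → c l ≡ false) → ∀ j → lincomb c V j ≡ false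
lincomb-zeroˡ V c≗0 j = ⊕-zero (λ l → cong (_∧ V l j) (c≗0 l))

lincomb-zero-column : ∀ {k n} (c : Fin k → Bool) (V : Mat k n) {j} →
                      (∀ l → V l j ≡ false) → lincomb c V j ≡ false
lincomb-zero-column c V column≡0 =
  ⊕-zero (λ l → trans (cong (c l ∧_) (column≡0 l)) (∧-zeroʳ (c l)))

lincomb-· : ∀ {k w n} (c : Fin k → Bool) (e : Mat k w) (U : Mat w n) j →
            lincomb c (e · U) j ≡ lincomb (lincomb c e) U j
lincomb-· c e U j = begin
  ⊕ (λ t → c t ∧ ⊕ (λ l → e t l ∧ U l j))
    ≡⟨ ⊕-cong (λ t → ∧-distribˡ-⊕ (c t) (λ l → e t l ∧ U l j)) ⟩
  ⊕ (λ t → ⊕ (λ l → c t ∧ (e t l ∧ U l j)))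
    ≡⟨ ⊕-comm (λ t l → c t ∧ (e t l ∧ U l j)) ⟩
  ⊕ (λ l → ⊕ (λ t → c t ∧ (e t l ∧ U l j)))
    ≡⟨ ⊕-cong (λ l → ⊕-cong (λ t → ∧-assoc (c t) (e t l) (U l j))) ⟨
  ⊕ (λ l → ⊕ (λ t → (c t ∧ e t l) ∧ U l j))
    ≡⟨ ⊕-cong (λ l → ∧-distribʳ-⊕ (U l j) (λ t → c t ∧ e t l)) ⟨
  ⊕ (λ l → ⊕ (λ t → c t ∧ e t l) ∧ U l j)
    ∎
  where open ≡-Reasoning

lincomb-insertAt : ∀ {k n} (c : Fin k → Bool) p x (V : Mat (suc k) n) j →
                   lincomb (insertAt c p x) V j ≡ (x ∧ V p j) xor lincomb c (removeAt V p) j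
lincomb-insertAt c p x V j = begin
  lincomb c′ V j
    ≡⟨ ⊕-removeAt (λ l → c′ l ∧ V l j) p ⟩
  (c′ p ∧ V p j) xor ⊕ (λ l → c′ (punchIn p l) ∧ V (punchIn p l) j)
    ≡⟨ cong₂ _xor_ (cong (_∧ V p j) (insertAt-lookup c p x))
                   (⊕-cong (λ l → cong (_∧ V (punchIn p l) j) (insertAt-punchIn c p x l))) ⟩
  (x ∧ V p j) xor lincomb c (removeAt V p) j
    ∎
  where
  open ≡-Reasoning
  c′ = insertAt c p x

lincomb-rank-one-update : ∀ {k n} (c : Fin k → Bool) (V : Mat k n) (u : Fin k → Bool)
                          (v : Fin n → Bool) j →
  lincomb c (λ l j → V l j xor (u l ∧ v j)) j
    ≡ lincomb c V j xor (⊕ (λ l → c l ∧ u l) ∧ v j)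
lincomb-rank-one-update c V u v j = begin
  ⊕ (λ l → c l ∧ (V l j xor (u l ∧ v j)))
    ≡⟨ ⊕-cong distribute ⟩
  ⊕ (λ l → (c l ∧ V l j) xor ((c l ∧ u l) ∧ v j))
    ≡⟨ ⊕-distrib-xor (λ l → c l ∧ V l j) (λ l → (c l ∧ u l) ∧ v j) ⟩
  lincomb c V j xor ⊕ (λ l → (c l ∧ u l) ∧ v j)
    ≡⟨ cong (lincomb c V j xor_) (∧-distribʳ-⊕ (v j) (λ l → c l ∧ u l)) ⟨
  lincomb c V j xor (⊕ (λ l → c l ∧ u l) ∧ v j)
    ∎
  where
  open ≡-Reasoning
  distribute : ∀ l → c l ∧ (V l j xor (u l ∧ v j)) ≡ (c l ∧ V l j) xor ((c l ∧ u l) ∧ v j)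
  distribute l = trans (∧-distribˡ-xor (c l) (V l j) (u l ∧ v j))
                       (cong ((c l ∧ V l j) xor_) (sym (∧-assoc (c l) (u l) (v j))))

RowsDependent : ∀ {k n} → Mat k n → Set
RowsDependent {k} V =
  ∃ λ (c : Fin k → Bool) → (∃ λ l → c l ≡ true) × (∀ j → lincomb c V j ≡ false)

RowsDependent-cong : ∀ {k n} {V W : Mat k n} → (∀ l j → V l j ≡ W l j) →
                     RowsDependent V → RowsDependent W
RowsDependent-cong V≗W (c , nonzero , rel) =
  c , nonzero , λ j → trans (⊕-cong (λ l → cong (c l ∧_) (sym (V≗W l j)))) (rel j)

RowsDependent-· : ∀ {k w n} {e : Mat k w} (U : Mat w n) →
                  RowsDependent e → RowsDependent (e · U)
RowsDependent-· {e = e} U (c , nonzero , rel) =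
  c , nonzero , λ j → trans (lincomb-· c e U j) (lincomb-zeroˡ U rel j)

LinIndepRows⇒¬RowsDependent : ∀ {m n k} (N : Mat m n) (κ : Fin k → Fin m) →
                              LinIndepRows N κ → ¬ RowsDependent (N ∘ κ)
LinIndepRows⇒¬RowsDependent N κ indep (c , (l , cl≡true) , rel)
  with () ← trans (sym cl≡true) (indep c rel l)

RowsDependent-dropColumn : ∀ {k w} (a : Mat k (suc w)) → (∀ l → a l zero ≡ false) →
                           RowsDependent (λ l j → a l (suc j)) → RowsDependent a
RowsDependent-dropColumn a column≡0 (c , nonzero , rel) =
  c , nonzero , λ { zero → lincomb-zero-column c a column≡0 ; (suc j) → rel j }

-- One step of Gaussian elimination: add a multiple of the pivot row p to the
-- other rows so as to clear column 0, then delete row p and column 0.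
eliminate : ∀ {k w} → Mat (suc k) (suc w) → Fin (suc k) → Mat k w
eliminate a p l j = removeAt a p l (suc j) xor (removeAt a p l zero ∧ a p (suc j))

RowsDependent-eliminate : ∀ {k w} (a : Mat (suc k) (suc w)) p → a p zero ≡ true →
                          RowsDependent (eliminate a p) → RowsDependent a
RowsDependent-eliminate a p pivot (c , (l , cl≡true) , rel) =
  insertAt c p S , (punchIn p l , trans (insertAt-punchIn c p S l) cl≡true) , rel′
  where
  open ≡-Reasoning
  -- the pivot row's coefficient, chosen to cancel column 0
  S : Bool
  S = lincomb c (removeAt a p) zero
  rel′ : ∀ j → lincomb (insertAt c p S) a j ≡ false
  rel′ zero = begin
    lincomb (insertAt c p S) a zero  ≡⟨ lincomb-insertAt c p S a zero ⟩
    (S ∧ a p zero) xor S             ≡⟨ cong (λ b → (S ∧ b) xor S) pivot ⟩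
    (S ∧ true) xor S                 ≡⟨ cong (_xor S) (∧-identityʳ S) ⟩
    S xor S                          ≡⟨ xor-same S ⟩
    false                            ∎
  rel′ (suc j) = begin
    lincomb (insertAt c p S) a (suc j)
      ≡⟨ lincomb-insertAt c p S a (suc j) ⟩
    (S ∧ a p (suc j)) xor lincomb c (removeAt a p) (suc j)
      ≡⟨ xor-comm (S ∧ a p (suc j)) (lincomb c (removeAt a p) (suc j)) ⟩
    lincomb c (removeAt a p) (suc j) xor (S ∧ a p (suc j))
      ≡⟨ lincomb-rank-one-update c (λ l j → removeAt a p l (suc j))
                                   (λ l → removeAt a p l zero) (a p ∘ suc) j ⟨
    lincomb c (eliminate a p) j
      ≡⟨ rel j ⟩
    false
      ∎

more-rows-than-columns⇒RowsDependent : ∀ {k w} (a : Mat k w) → w < k → RowsDependent a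
more-rows-than-columns⇒RowsDependent {suc k} {zero} a _ =
  (λ _ → true) , (zero , refl) , λ ()
more-rows-than-columns⇒RowsDependent {suc k} {suc w} a (s≤s w<k)
  with any? (λ l → a l zero ≟ true)
... | yes (p , pivot) =
  RowsDependent-eliminate a p pivot
    (more-rows-than-columns⇒RowsDependent (eliminate a p) w<k)
... | no noPivot =
  RowsDependent-dropColumn a (λ l → ¬-not (noPivot ∘ (l ,_)))
    (more-rows-than-columns⇒RowsDependent (λ l j → a l (suc j)) (m≤n⇒m≤1+n w<k))

_∈RowSpan_ : ∀ {k n} → (Fin n → Bool) → Mat k n → Set
v ∈RowSpan V = ∃ λ c → ∀ j → v j ≡ lincomb c V j

∈RowSpan-head : ∀ {k n} (u : Fin n → Bool) (V : Mat k n) → u ∈RowSpan (u ∷ V)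
∈RowSpan-head {k} u V =
  (true ∷ λ _ → false) ,
  λ j → sym (trans (cong (u j xor_) (⊕-zero {k} (λ _ → refl))) (xor-identityʳ (u j)))

∈RowSpan-tail : ∀ {k n} {v : Fin n → Bool} (u : Fin n → Bool) {V : Mat k n} →
                v ∈RowSpan V → v ∈RowSpan (u ∷ V)
∈RowSpan-tail u (c , v≡) = (false ∷ c) , v≡

_∈RowSpan?_ : ∀ {k n} (v : Fin n → Bool) (V : Mat k n) → Dec (v ∈RowSpan V)
v ∈RowSpan? V =
  map′ (λ (p , v≡) → lookup p , v≡) fromCoefficients
       (anySubset? λ p → all? λ j → v j ≟ lincomb (lookup p) V j)
  where
  fromCoefficients : v ∈RowSpan V → ∃ λ p → ∀ j → v j ≡ lincomb (lookup p) V j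
  fromCoefficients (c , v≡) =
    tabulate c ,
    λ j → trans (v≡ j) (⊕-cong λ l → cong (_∧ V l j) (sym (lookup∘tabulate c l)))

LinIndepRows-inRowSpan⇒≤ : ∀ {m n k w} (N : Mat m n) (κ : Fin k → Fin m) (U : Mat w n) →
                           LinIndepRows N κ → (∀ t → N (κ t) ∈RowSpan U) → k ≤ w
LinIndepRows-inRowSpan⇒≤ {k = k} {w} N κ U indep inSpan with k ≤? w
... | yes k≤w = k≤w
... | no k≰w = contradiction dependent (LinIndepRows⇒¬RowsDependent N κ indep)
  where
  dependent : RowsDependent (N ∘ κ)
  dependent = RowsDependent-cong (λ t j → sym (proj₂ (inSpan t) j))
    (RowsDependent-· U (more-rows-than-columns⇒RowsDependent (proj₁ ∘ inSpan) (≰⇒> k≰w)))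

LinIndepRows-∷ : ∀ {m n s} (N : Mat m n) (ι : Fin s → Fin m) i →
                 LinIndepRows N ι → ¬ (N i ∈RowSpan (N ∘ ι)) → LinIndepRows N (i ∷ ι)
LinIndepRows-∷ N ι i indep i∉span c rel =
  λ { zero → c₀≡false ; (suc l) → indep (c ∘ suc) (relWith c₀≡false) l }
  where
  rest : Fin _ → Bool
  rest = lincomb (c ∘ suc) (N ∘ ι)
  relWith : ∀ {b} → c zero ≡ b → ∀ j → (b ∧ N i j) xor rest j ≡ false
  relWith c₀≡b j = trans (cong (λ b → (b ∧ N i j) xor rest j) (sym c₀≡b)) (rel j)
  c₀≡false : c zero ≡ false
  c₀≡false = ¬-not λ c₀≡true → i∉span (c ∘ suc , xor≡false⇒≡ ∘ relWith c₀≡true)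

record RowBasis {m n} (N : Mat m n) : Set where
  field
    size        : ℕ
    rows        : Fin size → Fin m
    independent : LinIndepRows N rows
    spanning    : ∀ i → N i ∈RowSpan (N ∘ rows)

rowBasis : ∀ {m n} (N : Mat m n) → RowBasis N
rowBasis {zero} N = record
  { size = 0 ; rows = λ () ; independent = λ _ _ () ; spanning = λ () }
rowBasis {suc m} N with rowBasis (N ∘ suc)
... | record { size = s ; rows = ι ; independent = indep ; spanning = span }
  with N zero ∈RowSpan? (N ∘ suc ∘ ι)
... | yes inSpan = record
  { size        = s
  ; rows        = suc ∘ ι
  ; independent = indep
  ; spanning    = λ { zero → inSpan ; (suc i) → span i }
  }
... | no notInSpan = record
  { size        = suc s
  ; rows        = zero ∷ suc ∘ ι
  ; independent = LinIndepRows-∷ N (suc ∘ ι) zero indep notInSpan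
  ; spanning    = λ { zero    → ∈RowSpan-head (N zero) (N ∘ suc ∘ ι)
                    ; (suc i) → ∈RowSpan-tail (N zero) (span i) }
  }

RowBasis⇒HasRank : ∀ {m n} {N : Mat m n} (B : RowBasis N) → HasRank N (RowBasis.size B)
RowBasis⇒HasRank {N = N} B =
  (rows , independent) ,
  λ k κ indep → LinIndepRows-inRowSpan⇒≤ N κ (N ∘ rows) indep (spanning ∘ κ)
  where open RowBasis B

G·H-completes-A : ∀ {n m} (F : LinDepth2 n m) → IsCompletion (A F) (G F · H F)
G·H-completes-A F i j with D F i j in wired
... | true  = tt
... | false with C F i j in direct
...   | false = xor-identityʳ _
...   | true  = contradiction (trans (sym wired) (C-wired F i j direct)) λ ()

lemma2 : ∀ {n m : ℕ} (F : LinDepth2 n m) (r : ℕ) → MinRank (A F) r → r ≤ width F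
lemma2 F r (_ , minimal) =
  ≤-trans (minimal (G F · H F) size (G·H-completes-A F) (RowBasis⇒HasRank basis)) size≤width
  where
  basis = rowBasis (G F · H F)
  open RowBasis basis
  size≤width : size ≤ width F
  size≤width = LinIndepRows-inRowSpan⇒≤ (G F · H F) rows (H F) independent
                                         (λ t → G F (rows t) , λ j → refl)
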